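{- Let $G$ be a finite, connected multigraph without loop edges, $q\in V(G)$, and $D\in\operatorname{Div}(G)$. (a) If $E=D+\Delta(f)$ for some $f:V(G)\to\mathbb{Z}$, then $\mathcal{E}_q(E)=\mathcal{E}_q(D)+\sum_{v\in V(G)}(D+E)(v)\, f(v)-2\deg(E)\, f(q)$. (b) If $E=D-\Delta(\chi_A)$ for some $A\subseteq V(G)\setminus\{q\}$, then $\mathcal{E}_q(E)=\mathcal{E}_q(D)-\sum_{v\in A}(D+E)(v)$. If moreover $E(v)\ge 0$ for all $v\in A$, then $\mathcal{E}_q(E)\le \mathcal{E}_q(D)-\lambda(A)$, where $\lambda(A)$ is the number of edges with one endpoint in $A$ and the other in $V(G)\setminus A$.
   Context: $\operatorname{Div}(G)$ is the free abelian group on $V(G)$, $\deg(D)=\sum_vD(v)$. $\Delta(f)=\sum_v\Delta_v(f)(v)$ with $\Delta_v(f)=\sum_{\{v,w\}\in E(G)}(f(v)-f(w))$ (edges with multiplicity), for rational-valued $f$. $\chi_A$ is the $\{0,1\}$-valued indicator function of $A$. Energy pairing on degree-zero divisors: if $D_i=\Delta(f_i)$ with $f_i$ rational-valued, $\langle D_1,D_2\rangle=\sum_v f_1(v)D_2(v)$ (independent of choices). $\langle D,E\rangle_q=\langle D-\deg(D)(q),E-\deg(E)(q)\rangle$ and $\mathcal{E}_q(D)=\langle D,D\rangle_q$. -}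

module Defs where

open import Data.Nat as ℕ using (ℕ; zero; suc)
open import Data.Integer as ℤ using (ℤ; +_)
open import Data.Rational as ℚ using (ℚ)
open import Data.Fin using (Fin; zero; suc; _≟_)
open import Data.Fin.Subset using (Subset; Side; inside; outside)
open import Data.Vec using (lookup)
open import Data.Product using (Σ; _×_; _,_)
open import Data.Bool using (if_then_else_)
open import Relation.Nullary using (does)
open import Relation.Binary.PropositionalEquality using (_≡_)

Σℤ : ∀ {n} → (Fin n → ℤ) → ℤ
Σℤ {zero}  f = + 0
Σℤ {suc n} f = f zero ℤ.+ Σℤ (λ i → f (suc i))

Σℚ : ∀ {n} → (Fin n → ℚ) → ℚ
Σℚ {zero}  f = ℚ.0ℚ
Σℚ {suc n} f = f zero ℚ.+ Σℚ (λ i → f (suc i))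

Σℕ : ∀ {n} → (Fin n → ℕ) → ℕ
Σℕ {zero}  f = 0
Σℕ {suc n} f = f zero ℕ.+ Σℕ (λ i → f (suc i))

ι : ℤ → ℚ
ι z = z ℚ./ 1

-- A finite multigraph on vertex set Fin n, given by edge multiplicities
-- mult v w = number of edges between v and w; symmetric, no loop edges.
record Multigraph (n : ℕ) : Set where
  field
    mult     : Fin n → Fin n → ℕ
    sym      : ∀ v w → mult v w ≡ mult w v
    loopless : ∀ v → mult v v ≡ 0
open Multigraph public

data Walk {n} (G : Multigraph n) : Fin n → Fin n → Set where
  here : ∀ {u} → Walk G u u
  step : ∀ {u w v} → 0 ℕ.< mult G u w → Walk G w v → Walk G u v

Connected : ∀ {n} → Multigraph n → Set
Connected G = ∀ u v → Walk G u v

Div : ℕ → Set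
Div n = Fin n → ℤ

deg : ∀ {n} → Div n → ℤ
deg D = Σℤ D

pt : ∀ {n} → Fin n → Div n
pt q v = if does (v ≟ q) then + 1 else + 0

_+ᴰ_ : ∀ {n} → Div n → Div n → Div n
(D +ᴰ E) v = D v ℤ.+ E v

_-ᴰ_ : ∀ {n} → Div n → Div n → Div n
(D -ᴰ E) v = D v ℤ.- E v

_·ᴰ_ : ∀ {n} → ℤ → Div n → Div n
(k ·ᴰ D) v = k ℤ.* D v

Δℤ : ∀ {n} → Multigraph n → (Fin n → ℤ) → Div n
Δℤ G f v = Σℤ (λ w → + mult G v w ℤ.* (f v ℤ.- f w))

Δℚ : ∀ {n} → Multigraph n → (Fin n → ℚ) → Fin n → ℚ
Δℚ G f v = Σℚ (λ w → ι (+ mult G v w) ℚ.* (f v ℚ.- f w))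

-- Energy pairing on degree-zero divisors, as a relation:
-- ⟨ D₁ , D₂ ⟩ ≈ x  iff  D₁ = Δ(f₁) for some rational f₁ with x = Σ_v f₁(v) D₂(v).
-- (Well-definedness/independence of f₁ is part of the paper's definition.)
EnergyPairing : ∀ {n} → Multigraph n → Div n → Div n → ℚ → Set
EnergyPairing G D₁ D₂ x =
  Σ (Fin _ → ℚ) λ f₁ → (∀ v → Δℚ G f₁ v ≡ ι (D₁ v)) × (x ≡ Σℚ (λ v → f₁ v ℚ.* ι (D₂ v)))

reduce : ∀ {n} → Fin n → Div n → Div n
reduce q D = D -ᴰ (deg D ·ᴰ pt q)

EnergyPairingAt : ∀ {n} → Multigraph n → Fin n → Div n → Div n → ℚ → Set
EnergyPairingAt G q D E x = EnergyPairing G (reduce q D) (reduce q E) x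

Energy : ∀ {n} → Multigraph n → Fin n → Div n → ℚ → Set
Energy G q D x = EnergyPairingAt G q D D x

χ : ∀ {n} → Subset n → Fin n → ℤ
χ A v with lookup A v
... | inside  = + 1
... | outside = + 0

ΣIn : ∀ {n} → Subset n → (Fin n → ℤ) → ℤ
ΣIn A g = Σℤ (λ v → χ A v ℤ.* g v)

cutSize : ∀ {n} → Multigraph n → Subset n → ℕ
cutSize {n} G A = Σℕ (λ v → Σℕ (λ w → cross (lookup A v) (lookup A w) (mult G v w)))
  where
  cross : Side → Side → ℕ → ℕ
  cross inside outside m = m
  cross _      _       m = 0

-- The pairing ⟨D, E⟩ = Σ g E (with D = Δ g) is well behaved because Δ is self-adjoint.
-- If the reduced divisors satisfy E' = D' + Δ f, write D' = Δ g and E' = Δ k; then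
-- ℰ(E) = Σ k Δ(g + f) = Σ (g + f) E' = ℰ(D) + Σ f (D' + E'), and replacing D', E' by D, E
-- costs deg(D) f(q) + deg(E) f(q) = 2 deg(E) f(q). Part (b) is the case f = -χ_A, where
-- f(q) = 0; and from D = E + Δ χ_A we get Σ_A (D + E) = 2 Σ_A E + Σ_A Δ χ_A, whose last
-- term counts the edges leaving A.
module Submission where

open import Defs
open import Data.Nat using (ℕ)
open import Data.Integer as ℤ using (ℤ; +_)
open import Data.Rational as ℚ using (ℚ)
open import Data.Fin using (Fin)
open import Data.Fin.Subset using (Subset; _∈_; _∉_)
open import Data.Product using (_×_)
open import Relation.Binary.PropositionalEquality using (_≡_)

open import Algebra.Bundles using (CommutativeMonoid)
import Algebra.Properties.CommutativeSemigroup as CommutativeSemigroupProperties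
open import Data.Nat using (zero; suc)
open import Data.Fin using (zero; suc)
open import Data.Fin.Subset using (inside; outside)
open import Data.Vec using (lookup)
open import Data.Vec.Properties using (lookup⇒[]=)
open import Data.Product using (Σ; _,_; proj₁; proj₂)
open import Data.Rational using (_+_; _*_; -_; _-_; 0ℚ; 1ℚ; _≤_)
import Data.Integer.Properties as ℤ
import Data.Rational.Properties as ℚ
import Data.Rational.Unnormalised as ℚᵘ
import Data.Rational.Unnormalised.Properties as ℚᵘ
open import Data.Empty using (⊥-elim)
open import Function using (_∘_)
open import Level using (0ℓ)
open import Relation.Binary.PropositionalEquality as ≡
  using (refl; trans; cong; cong₂; module ≡-Reasoning)
open import Relation.Nullary.Decidable using (dec⇒maybe)
import Data.Integer.Tactic.RingSolver as ℤ-Solver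
open import Tactic.RingSolver using (solve-∀)
import Tactic.RingSolver.Core.AlmostCommutativeRing as ACR

ℚ-ring : ACR.AlmostCommutativeRing 0ℓ 0ℓ
ℚ-ring = ACR.fromCommutativeRing ℚ.+-*-commutativeRing (λ x → dec⇒maybe (0ℚ ℚ.≟ x))

private
  module ℤ+ = CommutativeSemigroupProperties ℤ.+-commutativeSemigroup
  module ℚ+ = CommutativeSemigroupProperties
    (CommutativeMonoid.commutativeSemigroup ℚ.+-0-commutativeMonoid)

-- ι z = z / 1 is definitionally ℚ.fromℚᵘ (mkℚᵘ z 0), so its laws are checked in ℚᵘ.
toℚᵘ-ι : ∀ z → ℚ.toℚᵘ (ι z) ℚᵘ.≃ ℚᵘ.mkℚᵘ z 0
toℚᵘ-ι z = ℚ.toℚᵘ-fromℚᵘ (ℚᵘ.mkℚᵘ z 0)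

ι-≃ : ∀ {z p} → ℚᵘ.mkℚᵘ z 0 ℚᵘ.≃ ℚ.toℚᵘ p → ι z ≡ p
ι-≃ {p = p} z≃p = trans (ℚ.fromℚᵘ-cong z≃p) (ℚ.fromℚᵘ-toℚᵘ p)

ι-+ : ∀ a b → ι (a ℤ.+ b) ≡ ι a + ι b
ι-+ a b = ι-≃ (begin
  ℚᵘ.mkℚᵘ (a ℤ.+ b) 0             ≈⟨ ℚᵘ.*≡* (cross-multiplied a b) ⟩
  ℚᵘ.mkℚᵘ a 0 ℚᵘ.+ ℚᵘ.mkℚᵘ b 0    ≈⟨ ℚᵘ.+-cong (toℚᵘ-ι a) (toℚᵘ-ι b) ⟨
  ℚ.toℚᵘ (ι a) ℚᵘ.+ ℚ.toℚᵘ (ι b)  ≈⟨ ℚ.toℚᵘ-homo-+ (ι a) (ι b) ⟨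
  ℚ.toℚᵘ (ι a + ι b)              ∎)
  where
  open ℚᵘ.≃-Reasoning
  cross-multiplied : ∀ a b → (a ℤ.+ b) ℤ.* + 1 ≡ (a ℤ.* + 1 ℤ.+ b ℤ.* + 1) ℤ.* + 1
  cross-multiplied = ℤ-Solver.solve-∀

ι-* : ∀ a b → ι (a ℤ.* b) ≡ ι a * ι b
ι-* a b = ι-≃ (begin
  ℚᵘ.mkℚᵘ (a ℤ.* b) 0             ≈⟨ ℚᵘ.*≡* refl ⟩
  ℚᵘ.mkℚᵘ a 0 ℚᵘ.* ℚᵘ.mkℚᵘ b 0    ≈⟨ ℚᵘ.*-cong (toℚᵘ-ι a) (toℚᵘ-ι b) ⟨
  ℚ.toℚᵘ (ι a) ℚᵘ.* ℚ.toℚᵘ (ι b)  ≈⟨ ℚ.toℚᵘ-homo-* (ι a) (ι b) ⟨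
  ℚ.toℚᵘ (ι a * ι b)              ∎)
  where open ℚᵘ.≃-Reasoning

ι-neg : ∀ a → ι (ℤ.- a) ≡ - ι a
ι-neg a = ι-≃ (begin
  ℚᵘ.mkℚᵘ (ℤ.- a) 0  ≈⟨ ℚᵘ.-‿cong (toℚᵘ-ι a) ⟨
  ℚᵘ.- ℚ.toℚᵘ (ι a)  ≈⟨ ℚ.toℚᵘ-homo‿- (ι a) ⟨
  ℚ.toℚᵘ (- ι a)     ∎)
  where open ℚᵘ.≃-Reasoning

ι-- : ∀ a b → ι (a ℤ.- b) ≡ ι a - ι b
ι-- a b = trans (ι-+ a (ℤ.- b)) (cong (_+_ (ι a)) (ι-neg b))

ι-mono-≤ : ∀ {a b} → a ℤ.≤ b → ι a ≤ ι b
ι-mono-≤ {a} {b} a≤b = ℚ.toℚᵘ-cancel-≤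
  (ℚᵘ.≤-respˡ-≃ (ℚᵘ.≃-sym (toℚᵘ-ι a)) (ℚᵘ.≤-respʳ-≃ (ℚᵘ.≃-sym (toℚᵘ-ι b))
    (ℚᵘ.*≤* (ℤ.*-monoʳ-≤-nonNeg (+ 1) a≤b))))

Σℚ-cong : ∀ {n} {f g : Fin n → ℚ} → (∀ v → f v ≡ g v) → Σℚ f ≡ Σℚ g
Σℚ-cong {zero}  f≗g = refl
Σℚ-cong {suc n} f≗g = cong₂ _+_ (f≗g zero) (Σℚ-cong (f≗g ∘ suc))

Σℚ-zero : ∀ n → Σℚ {n} (λ _ → 0ℚ) ≡ 0ℚ
Σℚ-zero zero    = refl
Σℚ-zero (suc n) = trans (ℚ.+-identityˡ _) (Σℚ-zero n)

Σℚ-distrib-+ : ∀ {n} (f g : Fin n → ℚ) → Σℚ (λ v → f v + g v) ≡ Σℚ f + Σℚ g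
Σℚ-distrib-+ {zero}  f g = refl
Σℚ-distrib-+ {suc n} f g =
  trans (cong (_+_ (f zero + g zero)) (Σℚ-distrib-+ (f ∘ suc) (g ∘ suc)))
    (ℚ+.interchange (f zero) (g zero) (Σℚ (f ∘ suc)) (Σℚ (g ∘ suc)))

Σℚ-distrib-neg : ∀ {n} (f : Fin n → ℚ) → Σℚ (λ v → - f v) ≡ - Σℚ f
Σℚ-distrib-neg {zero}  f = refl
Σℚ-distrib-neg {suc n} f =
  trans (cong (_+_ (- f zero)) (Σℚ-distrib-neg (f ∘ suc)))
    (≡.sym (ℚ.neg-distrib-+ (f zero) (Σℚ (f ∘ suc))))

Σℚ-distrib-- : ∀ {n} (f g : Fin n → ℚ) → Σℚ (λ v → f v - g v) ≡ Σℚ f - Σℚ g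
Σℚ-distrib-- f g = trans (Σℚ-distrib-+ f (λ v → - g v)) (cong (_+_ (Σℚ f)) (Σℚ-distrib-neg g))

*-distribˡ-Σℚ : ∀ {n} c (f : Fin n → ℚ) → c * Σℚ f ≡ Σℚ (λ v → c * f v)
*-distribˡ-Σℚ {zero}  c f = ℚ.*-zeroʳ c
*-distribˡ-Σℚ {suc n} c f =
  trans (ℚ.*-distribˡ-+ c _ _) (cong (_+_ (c * f zero)) (*-distribˡ-Σℚ c (f ∘ suc)))

Σℚ-comm : ∀ {m n} (F : Fin m → Fin n → ℚ) →
  Σℚ (λ v → Σℚ (λ w → F v w)) ≡ Σℚ (λ w → Σℚ (λ v → F v w))
Σℚ-comm {zero}  {n} F = ≡.sym (Σℚ-zero n)
Σℚ-comm {suc m}     F = trans (cong (_+_ (Σℚ (F zero))) (Σℚ-comm (F ∘ suc)))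
  (≡.sym (Σℚ-distrib-+ (F zero) (λ w → Σℚ (λ v → F (suc v) w))))

Σℚ-*-pt : ∀ {n} (q : Fin n) (f : Fin n → ℚ) → Σℚ (λ v → f v * ι (pt q v)) ≡ f q
Σℚ-*-pt {suc n} zero f = begin
  f zero * 1ℚ + Σℚ (λ v → f (suc v) * 0ℚ)
    ≡⟨ cong₂ _+_ (ℚ.*-identityʳ (f zero)) (Σℚ-cong (ℚ.*-zeroʳ ∘ f ∘ suc)) ⟩
  f zero + Σℚ {n} (λ _ → 0ℚ)  ≡⟨ cong (_+_ (f zero)) (Σℚ-zero n) ⟩
  f zero + 0ℚ                 ≡⟨ ℚ.+-identityʳ (f zero) ⟩
  f zero                      ∎
  where open ≡-Reasoning
Σℚ-*-pt {suc n} (suc q) f =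
  trans (cong₂ _+_ (ℚ.*-zeroʳ (f zero)) (Σℚ-*-pt q (f ∘ suc))) (ℚ.+-identityˡ (f (suc q)))

ι-Σℤ : ∀ {n} (f : Fin n → ℤ) → ι (Σℤ f) ≡ Σℚ (λ v → ι (f v))
ι-Σℤ {zero}  f = refl
ι-Σℤ {suc n} f = trans (ι-+ (f zero) _) (cong (_+_ (ι (f zero))) (ι-Σℤ (f ∘ suc)))

Σℤ-cong : ∀ {n} {f g : Fin n → ℤ} → (∀ v → f v ≡ g v) → Σℤ f ≡ Σℤ g
Σℤ-cong {zero}  f≗g = refl
Σℤ-cong {suc n} f≗g = cong₂ ℤ._+_ (f≗g zero) (Σℤ-cong (f≗g ∘ suc))

Σℤ-distrib-+ : ∀ {n} (f g : Fin n → ℤ) → Σℤ (λ v → f v ℤ.+ g v) ≡ Σℤ f ℤ.+ Σℤ g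
Σℤ-distrib-+ {zero}  f g = refl
Σℤ-distrib-+ {suc n} f g =
  trans (cong (ℤ._+_ (f zero ℤ.+ g zero)) (Σℤ-distrib-+ (f ∘ suc) (g ∘ suc)))
    (ℤ+.interchange (f zero) (g zero) (Σℤ (f ∘ suc)) (Σℤ (g ∘ suc)))

Σℤ-distrib-neg : ∀ {n} (f : Fin n → ℤ) → Σℤ (λ v → ℤ.- f v) ≡ ℤ.- Σℤ f
Σℤ-distrib-neg {zero}  f = refl
Σℤ-distrib-neg {suc n} f =
  trans (cong (ℤ._+_ (ℤ.- f zero)) (Σℤ-distrib-neg (f ∘ suc)))
    (≡.sym (ℤ.neg-distrib-+ (f zero) (Σℤ (f ∘ suc))))

*-distribˡ-Σℤ : ∀ {n} c (f : Fin n → ℤ) → c ℤ.* Σℤ f ≡ Σℤ (λ v → c ℤ.* f v)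
*-distribˡ-Σℤ {zero}  c f = ℤ.*-zeroʳ c
*-distribˡ-Σℤ {suc n} c f =
  trans (ℤ.*-distribˡ-+ c _ _) (cong (ℤ._+_ (c ℤ.* f zero)) (*-distribˡ-Σℤ c (f ∘ suc)))

Σℤ-nonNeg : ∀ {n} (f : Fin n → ℤ) → (∀ v → + 0 ℤ.≤ f v) → + 0 ℤ.≤ Σℤ f
Σℤ-nonNeg {zero}  f f≥0 = ℤ.≤-refl
Σℤ-nonNeg {suc n} f f≥0 = ℤ.+-mono-≤ (f≥0 zero) (Σℤ-nonNeg (f ∘ suc) (f≥0 ∘ suc))

+-Σℕ : ∀ {n} (f : Fin n → ℕ) → + Σℕ f ≡ Σℤ (λ v → + f v)
+-Σℕ {zero}  f = refl
+-Σℕ {suc n} f = trans (ℤ.pos-+ (f zero) _) (cong (ℤ._+_ (+ f zero)) (+-Σℕ (f ∘ suc)))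

-- The Laplacian

multℚ : ∀ {n} → Multigraph n → Fin n → Fin n → ℚ
multℚ G v w = ι (+ mult G v w)

Δℚ-+ : ∀ {n} (G : Multigraph n) (g h : Fin n → ℚ) v →
  Δℚ G (λ u → g u + h u) v ≡ Δℚ G g v + Δℚ G h v
Δℚ-+ {n} G g h v = trans (Σℚ-cong λ w → split (multℚ G v w) (g v) (h v) (g w) (h w))
  (Σℚ-distrib-+ {n} _ _)
  where
  split : ∀ m a b c d → m * ((a + b) - (c + d)) ≡ m * (a - c) + m * (b - d)
  split = solve-∀ ℚ-ring

Δℚ-const : ∀ {n} (G : Multigraph n) c v → Δℚ G (λ _ → c) v ≡ 0ℚ
Δℚ-const {n} G c v = trans
  (Σℚ-cong λ w → trans (cong (multℚ G v w *_) (ℚ.+-inverseʳ c)) (ℚ.*-zeroʳ (multℚ G v w)))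
  (Σℚ-zero n)

Σℚ-*-Δℚ : ∀ {n} (G : Multigraph n) (a h : Fin n → ℚ) →
  Σℚ (λ v → a v * Δℚ G h v) ≡
  Σℚ (λ v → Σℚ (λ w → multℚ G v w * (a v * h v))) - Σℚ (λ v → Σℚ (λ w → multℚ G v w * (a v * h w)))
Σℚ-*-Δℚ {n} G a h = trans (Σℚ-cong expand) (Σℚ-distrib-- {n} _ _)
  where
  distrib : ∀ a m x y → a * (m * (x - y)) ≡ m * (a * x) - m * (a * y)
  distrib = solve-∀ ℚ-ring
  expand : ∀ v → a v * Δℚ G h v ≡
    Σℚ (λ w → multℚ G v w * (a v * h v)) - Σℚ (λ w → multℚ G v w * (a v * h w))
  expand v = trans (*-distribˡ-Σℚ {n} (a v) _)
    (trans (Σℚ-cong λ w → distrib (a v) (multℚ G v w) (h v) (h w)) (Σℚ-distrib-- {n} _ _))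

Δℚ-selfAdjoint : ∀ {n} (G : Multigraph n) (a h : Fin n → ℚ) →
  Σℚ (λ v → a v * Δℚ G h v) ≡ Σℚ (λ v → h v * Δℚ G a v)
Δℚ-selfAdjoint {n} G a h = begin
  Σℚ (λ v → a v * Δℚ G h v)
    ≡⟨ Σℚ-*-Δℚ G a h ⟩
  Σℚ (λ v → Σℚ (λ w → multℚ G v w * (a v * h v))) - Σℚ (λ v → Σℚ (λ w → multℚ G v w * (a v * h w)))
    ≡⟨ cong₂ _-_ (Σℚ-cong λ v → Σℚ-cong λ w → cong (multℚ G v w *_) (ℚ.*-comm (a v) (h v))) swapped ⟩
  Σℚ (λ v → Σℚ (λ w → multℚ G v w * (h v * a v))) - Σℚ (λ v → Σℚ (λ w → multℚ G v w * (h v * a w)))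
    ≡⟨ Σℚ-*-Δℚ G h a ⟨
  Σℚ (λ v → h v * Δℚ G a v)
    ∎
  where
  open ≡-Reasoning
  swapped : Σℚ (λ v → Σℚ (λ w → multℚ G v w * (a v * h w))) ≡
            Σℚ (λ v → Σℚ (λ w → multℚ G v w * (h v * a w)))
  swapped = trans (Σℚ-comm {n} {n} _) (Σℚ-cong λ v → Σℚ-cong λ w →
    cong₂ _*_ (cong (λ k → ι (+ k)) (Multigraph.sym G w v)) (ℚ.*-comm (a w) (h v)))

Σℚ-Δℚ : ∀ {n} (G : Multigraph n) (h : Fin n → ℚ) → Σℚ (Δℚ G h) ≡ 0ℚ
Σℚ-Δℚ {n} G h = begin
  Σℚ (Δℚ G h)                         ≡⟨ Σℚ-cong (λ v → ℚ.*-identityˡ (Δℚ G h v)) ⟨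
  Σℚ (λ v → 1ℚ * Δℚ G h v)            ≡⟨ Δℚ-selfAdjoint G (λ _ → 1ℚ) h ⟩
  Σℚ (λ v → h v * Δℚ G (λ _ → 1ℚ) v)  ≡⟨ Σℚ-cong (λ v → cong (h v *_) (Δℚ-const G 1ℚ v)) ⟩
  Σℚ (λ v → h v * 0ℚ)                 ≡⟨ Σℚ-cong (ℚ.*-zeroʳ ∘ h) ⟩
  Σℚ {n} (λ _ → 0ℚ)                   ≡⟨ Σℚ-zero n ⟩
  0ℚ                                  ∎
  where open ≡-Reasoning

Δℚ-ι : ∀ {n} (G : Multigraph n) (f : Fin n → ℤ) v → Δℚ G (ι ∘ f) v ≡ ι (Δℤ G f v)
Δℚ-ι {n} G f v = ≡.sym (trans (ι-Σℤ {n} _) (Σℚ-cong λ w →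
  trans (ι-* (+ mult G v w) _) (cong (multℚ G v w *_) (ι-- (f v) (f w)))))

Δℤ-neg : ∀ {n} (G : Multigraph n) (f : Fin n → ℤ) v → Δℤ G (ℤ.-_ ∘ f) v ≡ ℤ.- Δℤ G f v
Δℤ-neg {n} G f v = trans (Σℤ-cong λ w → pull-neg (+ mult G v w) (f v) (f w)) (Σℤ-distrib-neg {n} _)
  where
  pull-neg : ∀ m a b → m ℤ.* (ℤ.- a ℤ.- ℤ.- b) ≡ ℤ.- (m ℤ.* (a ℤ.- b))
  pull-neg = ℤ-Solver.solve-∀

-- The energy under a Laplacian shift

record ShiftedBy {n} (G : Multigraph n) (F : Fin n → ℚ) (D E : Div n) : Set where
  constructor shifted
  field at : ∀ v → ι (E v) ≡ ι (D v) + Δℚ G F v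

deg-shift : ∀ {n} {G : Multigraph n} {F D E} → ShiftedBy G F D E → ι (deg E) ≡ ι (deg D)
deg-shift {n} {G} {F} {D} {E} (shifted E≡D+ΔF) = begin
  ι (deg E)                          ≡⟨ ι-Σℤ E ⟩
  Σℚ (ι ∘ E)                         ≡⟨ Σℚ-cong E≡D+ΔF ⟩
  Σℚ (λ v → ι (D v) + Δℚ G F v)      ≡⟨ Σℚ-distrib-+ (ι ∘ D) (Δℚ G F) ⟩
  Σℚ (ι ∘ D) + Σℚ (Δℚ G F)           ≡⟨ cong (_+_ (Σℚ (ι ∘ D))) (Σℚ-Δℚ G F) ⟩
  Σℚ (ι ∘ D) + 0ℚ                    ≡⟨ ℚ.+-identityʳ _ ⟩
  Σℚ (ι ∘ D)                         ≡⟨ ι-Σℤ D ⟨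
  ι (deg D)                          ∎
  where open ≡-Reasoning

energyPairing-shift : ∀ {n} {G : Multigraph n} {F D E eD eE} → ShiftedBy G F D E →
  EnergyPairing G D D eD → EnergyPairing G E E eE →
  eE ≡ eD + (Σℚ (λ v → F v * ι (D v)) + Σℚ (λ v → F v * ι (E v)))
energyPairing-shift {n} {G} {F} {D} {E} {eD} {eE} (shifted E≡D+ΔF) (g , Δg≡D , eD≡) (k , Δk≡E , eE≡) =
  begin
    eE
      ≡⟨ eE≡ ⟩
    Σℚ (λ v → k v * ι (E v))
      ≡⟨ Σℚ-cong (λ v → cong (k v *_) (Δ[g+F]≡E v)) ⟨
    Σℚ (λ v → k v * Δℚ G g+F v)
      ≡⟨ Δℚ-selfAdjoint G k g+F ⟩
    Σℚ (λ v → g+F v * Δℚ G k v)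
      ≡⟨ Σℚ-cong (λ v → trans (cong (g+F v *_) (Δk≡E v)) (ℚ.*-distribʳ-+ (ι (E v)) (g v) (F v))) ⟩
    Σℚ (λ v → g v * ι (E v) + F v * ι (E v))
      ≡⟨ Σℚ-distrib-+ (λ v → g v * ι (E v)) _ ⟩
    Σℚ (λ v → g v * ι (E v)) + ΣFE
      ≡⟨ cong (_+ ΣFE) ΣgE≡eD+ΣFD ⟩
    eD + ΣFD + ΣFE
      ≡⟨ ℚ.+-assoc eD ΣFD ΣFE ⟩
    eD + (ΣFD + ΣFE)
      ∎
  where
  open ≡-Reasoning
  ΣFD ΣFE : ℚ
  ΣFD = Σℚ (λ v → F v * ι (D v))
  ΣFE = Σℚ (λ v → F v * ι (E v))
  g+F : Fin n → ℚ
  g+F v = g v + F v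
  Δ[g+F]≡E : ∀ v → Δℚ G g+F v ≡ ι (E v)
  Δ[g+F]≡E v = trans (Δℚ-+ G g F v) (trans (cong (_+ Δℚ G F v) (Δg≡D v)) (≡.sym (E≡D+ΔF v)))
  ΣgE≡eD+ΣFD : Σℚ (λ v → g v * ι (E v)) ≡ eD + ΣFD
  ΣgE≡eD+ΣFD = begin
    Σℚ (λ v → g v * ι (E v))
      ≡⟨ Σℚ-cong (λ v → trans (cong (g v *_) (E≡D+ΔF v)) (ℚ.*-distribˡ-+ (g v) (ι (D v)) (Δℚ G F v))) ⟩
    Σℚ (λ v → g v * ι (D v) + g v * Δℚ G F v)
      ≡⟨ Σℚ-distrib-+ (λ v → g v * ι (D v)) _ ⟩
    Σℚ (λ v → g v * ι (D v)) + Σℚ (λ v → g v * Δℚ G F v)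
      ≡⟨ cong₂ _+_ eD≡ (Δℚ-selfAdjoint G F g) ⟨
    eD + Σℚ (λ v → F v * Δℚ G g v)
      ≡⟨ cong (_+_ eD) (Σℚ-cong (λ v → cong (F v *_) (Δg≡D v))) ⟩
    eD + ΣFD
      ∎

ι-reduce : ∀ {n} (q : Fin n) (D : Div n) v → ι (reduce q D v) ≡ ι (D v) - ι (deg D) * ι (pt q v)
ι-reduce q D v = trans (ι-- (D v) _) (cong (_-_ (ι (D v))) (ι-* (deg D) (pt q v)))

reduce-shift : ∀ {n} {G : Multigraph n} {F D E} (q : Fin n) → ShiftedBy G F D E →
  ShiftedBy G F (reduce q D) (reduce q E)
reduce-shift {G = G} {F} {D} {E} q E≡D+ΔF = shifted λ v → begin
    ι (reduce q E v)
      ≡⟨ ι-reduce q E v ⟩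
    ι (E v) - ι (deg E) * ι (pt q v)
      ≡⟨ cong₂ (λ x d → x - d * ι (pt q v)) (ShiftedBy.at E≡D+ΔF v) (deg-shift E≡D+ΔF) ⟩
    (ι (D v) + Δℚ G F v) - ι (deg D) * ι (pt q v)
      ≡⟨ move (ι (D v)) (Δℚ G F v) (ι (deg D) * ι (pt q v)) ⟩
    (ι (D v) - ι (deg D) * ι (pt q v)) + Δℚ G F v
      ≡⟨ cong (_+ Δℚ G F v) (ι-reduce q D v) ⟨
    ι (reduce q D v) + Δℚ G F v
      ∎
  where
  open ≡-Reasoning
  move : ∀ x y z → (x + y) - z ≡ (x - z) + y
  move = solve-∀ ℚ-ring

Σℚ-*-reduce : ∀ {n} (q : Fin n) (F : Fin n → ℚ) (D : Div n) →
  Σℚ (λ v → F v * ι (reduce q D v)) ≡ Σℚ (λ v → F v * ι (D v)) - ι (deg D) * F q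
Σℚ-*-reduce q F D = begin
  Σℚ (λ v → F v * ι (reduce q D v))
    ≡⟨ Σℚ-cong (λ v → trans (cong (F v *_) (ι-reduce q D v)) (distrib (F v) (ι (D v)) d (ι (pt q v)))) ⟩
  Σℚ (λ v → F v * ι (D v) - d * (F v * ι (pt q v)))
    ≡⟨ Σℚ-distrib-- (λ v → F v * ι (D v)) _ ⟩
  ΣFD - Σℚ (λ v → d * (F v * ι (pt q v)))
    ≡⟨ cong (_-_ ΣFD) (*-distribˡ-Σℚ d (λ v → F v * ι (pt q v))) ⟨
  ΣFD - d * Σℚ (λ v → F v * ι (pt q v))
    ≡⟨ cong (λ x → ΣFD - d * x) (Σℚ-*-pt q F) ⟩
  ΣFD - d * F q
    ∎
  where
  open ≡-Reasoning
  d ΣFD : ℚ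
  d = ι (deg D)
  ΣFD = Σℚ (λ v → F v * ι (D v))
  distrib : ∀ f x d p → f * (x - d * p) ≡ f * x - d * (f * p)
  distrib = solve-∀ ℚ-ring

energy-shift : ∀ {n} {G : Multigraph n} {F D E eD eE} (q : Fin n) → ShiftedBy G F D E →
  Energy G q D eD → Energy G q E eE →
  eE ≡ (eD + Σℚ (λ v → ι ((D +ᴰ E) v) * F v)) - ι (+ 2 ℤ.* deg E) * F q
energy-shift {G = G} {F} {D} {E} {eD} {eE} q E≡D+ΔF ℰD ℰE = begin
  eE
    ≡⟨ energyPairing-shift (reduce-shift q E≡D+ΔF) ℰD ℰE ⟩
  eD + (Σℚ (λ v → F v * ι (reduce q D v)) + Σℚ (λ v → F v * ι (reduce q E v)))
    ≡⟨ cong₂ (λ x y → eD + (x + y)) (Σℚ-*-reduce q F D) (Σℚ-*-reduce q F E) ⟩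
  eD + ((ΣFD - ι (deg D) * F q) + (ΣFE - ι (deg E) * F q))
    ≡⟨ cong (λ d → eD + ((ΣFD - d * F q) + (ΣFE - ι (deg E) * F q))) (deg-shift E≡D+ΔF) ⟨
  eD + ((ΣFD - ι (deg E) * F q) + (ΣFE - ι (deg E) * F q))
    ≡⟨ regroup eD ΣFD ΣFE (ι (deg E)) (F q) ⟩
  (eD + (ΣFD + ΣFE)) - (1ℚ + 1ℚ) * ι (deg E) * F q
    ≡⟨ cong₂ (λ x c → (eD + x) - c * F q) Σ[D+E]F (ι-* (+ 2) (deg E)) ⟨
  (eD + Σℚ (λ v → ι ((D +ᴰ E) v) * F v)) - ι (+ 2 ℤ.* deg E) * F q ∎
  where
  open ≡-Reasoning
  ΣFD ΣFE : ℚ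
  ΣFD = Σℚ (λ v → F v * ι (D v))
  ΣFE = Σℚ (λ v → F v * ι (E v))
  -- ι (+ 2) computes to 1ℚ + 1ℚ, which the ring solver can handle.
  regroup : ∀ e a b d x → e + ((a - d * x) + (b - d * x)) ≡ (e + (a + b)) - (1ℚ + 1ℚ) * d * x
  regroup = solve-∀ ℚ-ring
  distrib : ∀ a b f → (a + b) * f ≡ f * a + f * b
  distrib = solve-∀ ℚ-ring
  Σ[D+E]F : Σℚ (λ v → ι ((D +ᴰ E) v) * F v) ≡ ΣFD + ΣFE
  Σ[D+E]F = trans
    (Σℚ-cong λ v → trans (cong (_* F v) (ι-+ (D v) (E v))) (distrib (ι (D v)) (ι (E v)) (F v)))
    (Σℚ-distrib-+ (λ v → F v * ι (D v)) _)

energy-shiftℤ : ∀ {n} (G : Multigraph n) (q : Fin n) (D : Div n) (f : Fin n → ℤ) (E : Div n) →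
  (∀ v → E v ≡ (D +ᴰ Δℤ G f) v) → ∀ eD eE → Energy G q D eD → Energy G q E eE →
  eE ≡ (eD + ι (Σℤ (λ v → (D +ᴰ E) v ℤ.* f v))) - ι (+ 2 ℤ.* deg E ℤ.* f q)
energy-shiftℤ {n} G q D f E E≡D+Δf eD eE ℰD ℰE = trans (energy-shift q shift ℰD ℰE)
  (cong₂ (λ s c → (eD + s) - c) (≡.sym ι-Σ[D+E]f) (≡.sym (ι-* (+ 2 ℤ.* deg E) (f q))))
  where
  shift : ShiftedBy G (ι ∘ f) D E
  shift = shifted λ v →
    trans (cong ι (E≡D+Δf v)) (trans (ι-+ (D v) _) (cong (_+_ (ι (D v))) (≡.sym (Δℚ-ι G f v))))
  ι-Σ[D+E]f : ι (Σℤ (λ v → (D +ᴰ E) v ℤ.* f v)) ≡ Σℚ (λ v → ι ((D +ᴰ E) v) * ι (f v))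
  ι-Σ[D+E]f = trans (ι-Σℤ {n} _) (Σℚ-cong λ v → ι-* ((D +ᴰ E) v) (f v))

-- Firing a set of vertices

χ-∉ : ∀ {n} {A : Subset n} {q} → q ∉ A → χ A q ≡ + 0
χ-∉ {A = A} {q} q∉A with lookup A q in eq
... | inside  = ⊥-elim (q∉A (lookup⇒[]= q A eq))
... | outside = refl

ΣIn-distrib-+ : ∀ {n} (A : Subset n) (g h : Div n) → ΣIn A (g +ᴰ h) ≡ ΣIn A g ℤ.+ ΣIn A h
ΣIn-distrib-+ A g h = trans (Σℤ-cong λ v → ℤ.*-distribˡ-+ (χ A v) (g v) (h v))
  (Σℤ-distrib-+ (λ v → χ A v ℤ.* g v) (λ v → χ A v ℤ.* h v))

ΣIn-nonNeg : ∀ {n} (A : Subset n) (g : Div n) → (∀ v → v ∈ A → + 0 ℤ.≤ g v) → + 0 ℤ.≤ ΣIn A g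
ΣIn-nonNeg A g g≥0 = Σℤ-nonNeg (λ v → χ A v ℤ.* g v) term≥0
  where
  term≥0 : ∀ v → + 0 ℤ.≤ χ A v ℤ.* g v
  term≥0 v with lookup A v in eq
  ... | inside  =
    ℤ.≤-trans (g≥0 v (lookup⇒[]= v A eq)) (ℤ.≤-reflexive (≡.sym (ℤ.*-identityˡ (g v))))
  ... | outside = ℤ.≤-refl

-- The crossing count of cutSize is local to its where block; unification names it.
cutSize-unfold : ∀ {n} (G : Multigraph n) (A : Subset n) →
  Σ (Fin n → Fin n → ℕ) λ c → cutSize G A ≡ Σℕ (λ v → Σℕ (c v))
cutSize-unfold G A = _ , refl

crossings : ∀ {n} → Multigraph n → Subset n → Fin n → Fin n → ℕ
crossings G A = proj₁ (cutSize-unfold G A)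

χ-Δ-crossings : ∀ {n} (G : Multigraph n) (A : Subset n) v w →
  χ A v ℤ.* (+ mult G v w ℤ.* (χ A v ℤ.- χ A w)) ≡ + crossings G A v w
χ-Δ-crossings G A v w with lookup A v | lookup A w
... | inside  | inside  = trans (ℤ.*-identityˡ _) (ℤ.*-zeroʳ (+ mult G v w))
... | inside  | outside = trans (ℤ.*-identityˡ _) (ℤ.*-identityʳ _)
... | outside | _       = refl

ΣIn-Δχ≡cutSize : ∀ {n} (G : Multigraph n) (A : Subset n) → ΣIn A (Δℤ G (χ A)) ≡ + cutSize G A
ΣIn-Δχ≡cutSize {n} G A = begin
  ΣIn A (Δℤ G (χ A))
    ≡⟨ Σℤ-cong (λ v → *-distribˡ-Σℤ {n} (χ A v) _) ⟩
  Σℤ (λ v → Σℤ (λ w → χ A v ℤ.* (+ mult G v w ℤ.* (χ A v ℤ.- χ A w))))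
    ≡⟨ Σℤ-cong (λ v → Σℤ-cong (χ-Δ-crossings G A v)) ⟩
  Σℤ (λ v → Σℤ (λ w → + crossings G A v w))
    ≡⟨ Σℤ-cong (λ v → +-Σℕ (crossings G A v)) ⟨
  Σℤ (λ v → + Σℕ (crossings G A v))
    ≡⟨ +-Σℕ (λ v → Σℕ (crossings G A v)) ⟨
  + Σℕ (λ v → Σℕ (crossings G A v))
    ≡⟨ cong +_ (proj₂ (cutSize-unfold G A)) ⟨
  + cutSize G A ∎
  where open ≡-Reasoning

cutSize≤ΣIn : ∀ {n} (G : Multigraph n) (A : Subset n) (D E : Div n) →
  (∀ v → E v ≡ (D -ᴰ Δℤ G (χ A)) v) → (∀ v → v ∈ A → + 0 ℤ.≤ E v) →
  + cutSize G A ℤ.≤ ΣIn A (D +ᴰ E)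
cutSize≤ΣIn G A D E E≡D-Δχ E≥0 = begin
  + cutSize G A                      ≡⟨ ℤ.+-identityʳ _ ⟨
  + cutSize G A ℤ.+ + 0              ≤⟨ ℤ.+-monoʳ-≤ (+ cutSize G A) (ℤ.+-mono-≤ ΣE≥0 ΣE≥0) ⟩
  + cutSize G A ℤ.+ (ΣE ℤ.+ ΣE)      ≡⟨ regroup (+ cutSize G A) ΣE ⟩
  (ΣE ℤ.+ + cutSize G A) ℤ.+ ΣE      ≡⟨ cong (ℤ._+ ΣE) ΣD≡ΣE+cut ⟨
  ΣIn A D ℤ.+ ΣE                     ≡⟨ ΣIn-distrib-+ A D E ⟨
  ΣIn A (D +ᴰ E)                     ∎
  where
  open ℤ.≤-Reasoning
  ΣE : ℤ
  ΣE = ΣIn A E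
  ΣE≥0 : + 0 ℤ.≤ ΣE
  ΣE≥0 = ΣIn-nonNeg A E E≥0
  regroup : ∀ c s → c ℤ.+ (s ℤ.+ s) ≡ (s ℤ.+ c) ℤ.+ s
  regroup = ℤ-Solver.solve-∀
  unfire : ∀ d x → (d ℤ.- x) ℤ.+ x ≡ d
  unfire = ℤ-Solver.solve-∀
  D≡E+Δχ : ∀ v → D v ≡ (E +ᴰ Δℤ G (χ A)) v
  D≡E+Δχ v = ≡.sym (trans (cong (ℤ._+ Δℤ G (χ A) v) (E≡D-Δχ v)) (unfire (D v) _))
  ΣD≡ΣE+cut : ΣIn A D ≡ ΣE ℤ.+ + cutSize G A
  ΣD≡ΣE+cut = trans (Σℤ-cong λ v → cong (χ A v ℤ.*_) (D≡E+Δχ v))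
    (trans (ΣIn-distrib-+ A E (Δℤ G (χ A))) (cong (ℤ._+_ ΣE) (ΣIn-Δχ≡cutSize G A)))

energy-fire : ∀ {n} (G : Multigraph n) (q : Fin n) (D : Div n) (A : Subset n) → q ∉ A →
  (E : Div n) → (∀ v → E v ≡ (D -ᴰ Δℤ G (χ A)) v) → ∀ eD eE → Energy G q D eD → Energy G q E eE →
  eE ≡ eD - ι (ΣIn A (D +ᴰ E))
energy-fire {n} G q D A q∉A E E≡D-Δχ eD eE ℰD ℰE = begin
  eE
    ≡⟨ energy-shiftℤ G q D (ℤ.-_ ∘ χ A) E E≡D+Δ[-χ] eD eE ℰD ℰE ⟩
  (eD + ι (Σℤ (λ v → (D +ᴰ E) v ℤ.* ℤ.- χ A v))) - ι (+ 2 ℤ.* deg E ℤ.* ℤ.- χ A q)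
    ≡⟨ cong₂ (λ s c → (eD + ι s) - ι c) Σ[D+E][-χ] no-charge-at-q ⟩
  (eD + ι (ℤ.- ΣIn A (D +ᴰ E))) - 0ℚ
    ≡⟨ cong (λ x → (eD + x) - 0ℚ) (ι-neg (ΣIn A (D +ᴰ E))) ⟩
  (eD - ι (ΣIn A (D +ᴰ E))) - 0ℚ
    ≡⟨ ℚ.+-identityʳ _ ⟩
  eD - ι (ΣIn A (D +ᴰ E)) ∎
  where
  open ≡-Reasoning
  E≡D+Δ[-χ] : ∀ v → E v ≡ (D +ᴰ Δℤ G (ℤ.-_ ∘ χ A)) v
  E≡D+Δ[-χ] v = trans (E≡D-Δχ v) (cong (ℤ._+_ (D v)) (≡.sym (Δℤ-neg G (χ A) v)))
  Σ[D+E][-χ] : Σℤ (λ v → (D +ᴰ E) v ℤ.* ℤ.- χ A v) ≡ ℤ.- ΣIn A (D +ᴰ E)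
  Σ[D+E][-χ] = trans
    (Σℤ-cong λ v → trans (≡.sym (ℤ.neg-distribʳ-* ((D +ᴰ E) v) (χ A v)))
                         (cong ℤ.-_ (ℤ.*-comm ((D +ᴰ E) v) (χ A v))))
    (Σℤ-distrib-neg {n} _)
  no-charge-at-q : + 2 ℤ.* deg E ℤ.* ℤ.- χ A q ≡ + 0
  no-charge-at-q =
    trans (cong (λ z → + 2 ℤ.* deg E ℤ.* ℤ.- z) (χ-∉ q∉A)) (ℤ.*-zeroʳ (+ 2 ℤ.* deg E))

proposition4p2 : ∀ {n} (G : Multigraph n) → Connected G → (q : Fin n) (D : Div n) →
    ((f : Fin n → ℤ) (E : Div n) → (∀ v → E v ≡ (D +ᴰ Δℤ G f) v) →
      ∀ (eD eE : ℚ) → Energy G q D eD → Energy G q E eE →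
      eE ≡ (eD ℚ.+ ι (Σℤ (λ v → (D +ᴰ E) v ℤ.* f v))) ℚ.- ι (+ 2 ℤ.* deg E ℤ.* f q))
    ×
    ((A : Subset n) → q ∉ A → (E : Div n) → (∀ v → E v ≡ (D -ᴰ Δℤ G (χ A)) v) →
      ∀ (eD eE : ℚ) → Energy G q D eD → Energy G q E eE →
      (eE ≡ eD ℚ.- ι (ΣIn A (D +ᴰ E)))
      × ((∀ v → v ∈ A → + 0 ℤ.≤ E v) → eE ℚ.≤ eD ℚ.- ι (+ cutSize G A)))
proposition4p2 G _ q D = energy-shiftℤ G q D , λ A q∉A E E≡D-Δχ eD eE ℰD ℰE →
  let eE≡ = energy-fire G q D A q∉A E E≡D-Δχ eD eE ℰD ℰE in
  eE≡ , λ E≥0 → ℚ.≤-trans (ℚ.≤-reflexive eE≡)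
    (ℚ.+-monoʳ-≤ eD (ℚ.neg-antimono-≤ (ι-mono-≤ (cutSize≤ΣIn G A D E E≡D-Δχ E≥0))))
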